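{- As $n\to\infty$, \[\tfrac{n^2}{12}+O(n)\le\mathrm{sat}_\circlearrowright(n,D_2)\le\tfrac{5n^2}{24}+O(n).\]
   Context: $\Omega_n=\{v_0,\dots,v_{n-1}\}$ carries the cyclic order $v_0<\dots<v_{n-1}<v_0$. A $3$-cgh on $\Omega_n$ is a set $H\subseteq\binom{\Omega_n}{3}$. For a cgh $F$ on a cyclically ordered set $U$, $H$ contains a copy of $F$ if there is an injection $U\to\Omega_n$ preserving the cyclic order and mapping every edge of $F$ onto an edge of $H$; $H$ is $F$-saturated if it contains no copy of $F$ but $H\cup\{e\}$ does for every $e\in\binom{\Omega_n}{3}\setminus H$. $\mathrm{sat}_\circlearrowright(n,F)$ is the minimum number of edges of an $F$-saturated $3$-cgh on $\Omega_n$. $D_2$ is the $3$-cgh on cyclically ordered points $u_0<u_1<u_2<u_3<u_0$ with edges $\{u_0,u_1,u_2\}$ and $\{u_0,u_1,u_3\}$. -}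

module Defs where

open import Data.Nat using (ℕ; _≤_)
open import Data.Fin using (Fin; _<_)
open import Data.Product using (Σ; ∃; _×_; _,_)
open import Data.Sum using (_⊎_)
open import Data.List using (List; _∷_; length)
open import Data.List.Membership.Propositional using (_∈_; _∉_)
open import Data.List.Relation.Unary.All using (All)
open import Data.List.Relation.Unary.Unique.Propositional using (Unique)
open import Relation.Binary.PropositionalEquality using (_≡_)
open import Relation.Nullary using (¬_)

-- Ω_n = Fin n with cyclic order 0 < 1 < ... < n-1 < 0.
-- A triple (a , b , c) of vertices; an edge {a,b,c} is stored in sorted form a < b < c.
Triple : ℕ → Set
Triple n = Fin n × Fin n × Fin n

Sorted : ∀ {n} → Triple n → Set
Sorted (a , b , c) = a < b × b < c

-- A 3-cgh on Ω_n: a duplicate-free list of sorted triples (each 3-set stored once).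
record CGH (n : ℕ) : Set where
  constructor cgh
  field
    edges  : List (Triple n)
    sorted : All Sorted edges
    unique : Unique edges
open CGH public

∣_∣ₑ : ∀ {n} → CGH n → ℕ
∣ H ∣ₑ = length (edges H)

IsEdge : ∀ {n} → List (Triple n) → Fin n → Fin n → Fin n → Set
IsEdge E x y z =
  ((x , y , z) ∈ E) ⊎ ((x , z , y) ∈ E) ⊎ ((y , x , z) ∈ E) ⊎
  ((y , z , x) ∈ E) ⊎ ((z , x , y) ∈ E) ⊎ ((z , y , x) ∈ E)

-- (x₀,x₁,x₂,x₃) are distinct and appear in this cyclic order on Ω_n,
-- i.e. u_i ↦ x_i is an injection preserving the cyclic order u₀<u₁<u₂<u₃<u₀.
CycOrd4 : ∀ {n} → Fin n → Fin n → Fin n → Fin n → Set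
CycOrd4 x₀ x₁ x₂ x₃ =
  (x₀ < x₁ × x₁ < x₂ × x₂ < x₃) ⊎
  (x₁ < x₂ × x₂ < x₃ × x₃ < x₀) ⊎
  (x₂ < x₃ × x₃ < x₀ × x₀ < x₁) ⊎
  (x₃ < x₀ × x₀ < x₁ × x₁ < x₂)

-- E contains a copy of D₂ (edges {u₀,u₁,u₂}, {u₀,u₁,u₃})
ContainsD₂ : ∀ {n} → List (Triple n) → Set
ContainsD₂ {n} E =
  Σ (Fin n) λ x₀ → Σ (Fin n) λ x₁ → Σ (Fin n) λ x₂ → Σ (Fin n) λ x₃ →
    CycOrd4 x₀ x₁ x₂ x₃ × IsEdge E x₀ x₁ x₂ × IsEdge E x₀ x₁ x₃

D₂-Saturated : ∀ {n} → CGH n → Set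
D₂-Saturated {n} H =
  ¬ ContainsD₂ (edges H) ×
  (∀ (e : Triple n) → Sorted e → e ∉ edges H → ContainsD₂ (e ∷ edges H))

IsSatD₂ : ℕ → ℕ → Set
IsSatD₂ n k =
  (Σ (CGH n) λ H → D₂-Saturated H × ∣ H ∣ₑ ≡ k) ×
  (∀ (H : CGH n) → D₂-Saturated H → k ≤ ∣ H ∣ₑ)

module Submission where

-- Write δ x y for the length of the arc from x forward to y; the arcs of a triple x, y, z in
-- cyclic order are δ x y, δ y z, δ z x, and they sum to n.
--
-- Let H be D₂-saturated.  Every triple {x, y, z} in cyclic order has a pair x, y in
-- common with an edge {x, y, w} of H, w on the arc from y to x: if the triple is in H take w = z,
-- otherwise adding it to H creates a copy of D₂, whose other edge is such an edge.  An edge with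
-- arcs a, b, c arises this way for (n − 1 − a) + (n − 1 − b) + (n − 1 − c) < 2n triples, so
-- (n choose 3) ≤ 2n·|H|, i.e. |H| ≥ n²/12 − O(n).
--
-- Take n ≈ 6h and let H₀ consist of the triples whose arcs contain, in cyclic order,
-- two consecutive values d, d + h with 1 ≤ d ≤ h.  For x, y, z in H₀ the arc δ x y determines
-- δ y z (the other combinations are impossible when 5h < n), so the two edges {x₀, x₁, x₂} and
-- {x₀, x₁, x₃} of a copy of D₂ cannot both lie in H₀.  Any other triple has an arc of length at
-- most 2h, which completes to a triple of H₀ sharing that arc, and the two triples form a copy of
-- D₂.  Finally |H₀| ≤ n(h + 1) ≈ n²/6 ≤ 5n²/24.

open import Defs
open import Data.Empty using (⊥; ⊥-elim)
open import Data.Fin.Base using (Fin; toℕ; fromℕ<) renaming (_<_ to _≺_)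
import Data.Fin.Properties as Fin
open import Data.List.Base
  using (List; []; _∷_; _++_; map; concatMap; length; upTo; filter; allFin; cartesianProduct)
open import Data.List.Extrema.Nat using (argmin; argmin-all; f[argmin]≤f[⊤]; f[argmin]≤f[xs])
open import Data.List.Membership.Propositional using (_∈_; _∉_; lose)
open import Data.List.Membership.Propositional.Properties
open import Data.List.Properties using (length-++; length-map; length-upTo; length-tabulate)
open import Data.List.Relation.Binary.Subset.Propositional using (_⊆_)
open import Data.List.Relation.Binary.Subset.Propositional.Properties using (∷⁺ʳ)
open import Data.List.Relation.Unary.All as All using (All; []; _∷_)
open import Data.List.Relation.Unary.All.Properties using (anti-mono)
open import Data.List.Relation.Unary.AllPairs using ([]; _∷_)
open import Data.List.Relation.Unary.Any using (here; there)
open import Data.List.Relation.Unary.Unique.Propositional using (Unique)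
import Data.List.Relation.Unary.Unique.Propositional.Properties as Unique
open import Data.Nat.Base using (ℕ; zero; suc; _+_; _*_; _∸_; _≤_; _<_; z≤n; s≤s; z<s; >-nonZero)
open import Data.Nat.Properties
open import Data.Nat.Tactic.RingSolver using (solve-∀)
open import Data.Product.Base using (Σ; _×_; _,_; proj₁; proj₂; uncurry)
open import Data.Product.Properties using (≡-dec)
open import Data.Sum.Base using (_⊎_; inj₁; inj₂)
import Data.Sum.Base as Sum
open import Function.Base using (_∘_; id)
open import Relation.Binary.Definitions using (tri<; tri≈; tri>)
open import Relation.Binary.PropositionalEquality
open import Relation.Nullary using (¬_; Dec; yes; no; contradiction)
open import Relation.Nullary.Decidable using (_×-dec_; _⊎-dec_; _→-dec_; ¬?; map′)
open import Relation.Unary using (Decidable)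

Unique⇒length≤ : ∀ {A : Set} {xs ys : List A} → Unique xs → xs ⊆ ys → length xs ≤ length ys
Unique⇒length≤ {xs = []} _ _ = z≤n
Unique⇒length≤ {xs = x ∷ xs} {ys} (x∉xs ∷ u) xs⊆ys with ∈-∃++ (xs⊆ys (here refl))
... | ys₁ , ys₂ , refl = begin
  suc (length xs)                 ≤⟨ s≤s (Unique⇒length≤ u xs⊆ys₁++ys₂) ⟩
  suc (length (ys₁ ++ ys₂))       ≡⟨ cong suc (length-++ ys₁) ⟩
  suc (length ys₁ + length ys₂)   ≡⟨ +-suc (length ys₁) (length ys₂) ⟨
  length ys₁ + length (x ∷ ys₂)   ≡⟨ length-++ ys₁ ⟨
  length (ys₁ ++ x ∷ ys₂)         ∎
  where
  open ≤-Reasoning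
  xs⊆ys₁++ys₂ : xs ⊆ ys₁ ++ ys₂
  xs⊆ys₁++ys₂ {v} v∈xs with ∈-++⁻ ys₁ (xs⊆ys (there v∈xs))
  ... | inj₁ v∈ys₁         = ∈-++⁺ˡ v∈ys₁
  ... | inj₂ (here v≡x)    = ⊥-elim (All.lookup x∉xs v∈xs (sym v≡x))
  ... | inj₂ (there v∈ys₂) = ∈-++⁺ʳ ys₁ v∈ys₂

length-concatMap-≤ : ∀ {A B : Set} (f : A → List B) {k} xs →
                     (∀ {x} → x ∈ xs → length (f x) ≤ k) → length (concatMap f xs) ≤ length xs * k
length-concatMap-≤ f []       _ = z≤n
length-concatMap-≤ f (x ∷ xs) bound = begin
  length (f x ++ concatMap f xs)           ≡⟨ length-++ (f x) ⟩
  length (f x) + length (concatMap f xs)   ≤⟨ +-mono-≤ (bound (here refl)) (length-concatMap-≤ f xs (bound ∘ there)) ⟩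
  _                                        ∎
  where open ≤-Reasoning

sublists : ∀ {A : Set} → List A → List (List A)
sublists []       = [] ∷ []
sublists (x ∷ xs) = sublists xs ++ map (x ∷_) (sublists xs)

∈-sublists⇒⊆ : ∀ {A : Set} (xs : List A) {ys} → ys ∈ sublists xs → ys ⊆ xs
∈-sublists⇒⊆ [] (here refl) ()
∈-sublists⇒⊆ (x ∷ xs) ys∈ v∈ys with ∈-++⁻ (sublists xs) ys∈
... | inj₁ ys∈′ = there (∈-sublists⇒⊆ xs ys∈′ v∈ys)
... | inj₂ x∷ys∈ with ∈-map⁻ (x ∷_) x∷ys∈
...   | _ , ys∈′ , refl with v∈ys
...     | here v≡x = here v≡x
...     | there v∈ys′ = there (∈-sublists⇒⊆ xs ys∈′ v∈ys′)

∈-sublists⇒Unique : ∀ {A : Set} {xs ys : List A} → Unique xs → ys ∈ sublists xs → Unique ys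
∈-sublists⇒Unique {xs = []} _ (here refl) = []
∈-sublists⇒Unique {xs = x ∷ xs} (x∉xs ∷ u) ys∈ with ∈-++⁻ (sublists xs) ys∈
... | inj₁ ys∈′ = ∈-sublists⇒Unique u ys∈′
... | inj₂ x∷ys∈ with ∈-map⁻ (x ∷_) x∷ys∈
...   | _ , ys∈′ , refl = anti-mono (∈-sublists⇒⊆ xs ys∈′) x∉xs ∷ ∈-sublists⇒Unique u ys∈′

filter∈sublists : ∀ {A : Set} {P : A → Set} (P? : Decidable P) xs → filter P? xs ∈ sublists xs
filter∈sublists P? [] = here refl
filter∈sublists P? (x ∷ xs) with P? x
... | yes _ = ∈-++⁺ʳ (sublists xs) (∈-map⁺ (x ∷_) (filter∈sublists P? xs))
... | no  _ = ∈-++⁺ˡ (filter∈sublists P? xs)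

increasingPairs : ℕ → List (ℕ × ℕ)
increasingPairs zero    = []
increasingPairs (suc k) = increasingPairs k ++ map (_, k) (upTo k)

increasingTriples : ℕ → List (ℕ × ℕ × ℕ)
increasingTriples zero    = []
increasingTriples (suc k) = increasingTriples k ++ map (λ (a , b) → a , b , k) (increasingPairs k)

∈-increasingPairs⁻ : ∀ k {a b} → (a , b) ∈ increasingPairs k → a < b × b < k
∈-increasingPairs⁻ (suc k) ab∈ with ∈-++⁻ (increasingPairs k) ab∈
... | inj₁ ab∈′ with ∈-increasingPairs⁻ k ab∈′
...   | a<b , b<k = a<b , m<n⇒m<1+n b<k
∈-increasingPairs⁻ (suc k) ab∈ | inj₂ ab∈′ with ∈-map⁻ (_, k) ab∈′
...   | _ , a∈ , refl = ∈-upTo⁻ a∈ , n<1+n k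

∈-increasingTriples⁻ : ∀ k {a b c} → (a , b , c) ∈ increasingTriples k → a < b × b < c × c < k
∈-increasingTriples⁻ (suc k) abc∈ with ∈-++⁻ (increasingTriples k) abc∈
... | inj₁ abc∈′ with ∈-increasingTriples⁻ k abc∈′
...   | a<b , b<c , c<k = a<b , b<c , m<n⇒m<1+n c<k
∈-increasingTriples⁻ (suc k) abc∈ | inj₂ abc∈′ with ∈-map⁻ (λ (a , b) → a , b , k) abc∈′
...   | _ , ab∈ , refl with ∈-increasingPairs⁻ k ab∈
...     | a<b , b<k = a<b , b<k , n<1+n k

increasingPairs-Unique : ∀ k → Unique (increasingPairs k)
increasingPairs-Unique zero    = []
increasingPairs-Unique (suc k) =
  Unique.++⁺ (increasingPairs-Unique k) (Unique.map⁺ (cong proj₁) (Unique.upTo⁺ k)) disjoint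
  where
  disjoint : ∀ {p} → ¬ (p ∈ increasingPairs k × p ∈ map (_, k) (upTo k))
  disjoint (p∈ , p∈′) with ∈-map⁻ (_, k) p∈′
  ... | _ , _ , refl = <-irrefl refl (proj₂ (∈-increasingPairs⁻ k p∈))

increasingTriples-Unique : ∀ k → Unique (increasingTriples k)
increasingTriples-Unique zero    = []
increasingTriples-Unique (suc k) =
  Unique.++⁺ (increasingTriples-Unique k) (Unique.map⁺ append-k-injective (increasingPairs-Unique k)) disjoint
  where
  append-k-injective : ∀ {p q : ℕ × ℕ} → (proj₁ p , proj₂ p , k) ≡ (proj₁ q , proj₂ q , k) → p ≡ q
  append-k-injective refl = refl
  disjoint : ∀ {t} → ¬ (t ∈ increasingTriples k × t ∈ map (λ (a , b) → a , b , k) (increasingPairs k))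
  disjoint (t∈ , t∈′) with ∈-map⁻ (λ (a , b) → a , b , k) t∈′
  ... | _ , _ , refl = <-irrefl refl (proj₂ (proj₂ (∈-increasingTriples⁻ k t∈)))

-- 2·(k choose 2) = k² − k and 6·(k choose 3) = k³ − 3k² + 2k, with the subtractions moved to the left.
length-increasingPairs : ∀ k → 2 * length (increasingPairs k) + k ≡ k * k
length-increasingPairs zero    = refl
length-increasingPairs (suc k) = begin
  2 * length (increasingPairs k ++ map (_, k) (upTo k)) + suc k
    ≡⟨ cong (λ l → 2 * l + suc k) (trans (length-++ (increasingPairs k))
         (cong (p +_) (trans (length-map (_, k) (upTo k)) (length-upTo k)))) ⟩
  2 * (p + k) + suc k               ≡⟨ regroup p k ⟩
  (2 * p + k) + (2 * k + 1)         ≡⟨ cong (_+ (2 * k + 1)) (length-increasingPairs k) ⟩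
  k * k + (2 * k + 1)               ≡⟨ square-suc k ⟩
  suc k * suc k                     ∎
  where
  open ≡-Reasoning
  p : ℕ
  p = length (increasingPairs k)
  regroup : ∀ p k → 2 * (p + k) + suc k ≡ (2 * p + k) + (2 * k + 1)
  regroup = solve-∀
  square-suc : ∀ k → k * k + (2 * k + 1) ≡ suc k * suc k
  square-suc = solve-∀

length-increasingTriples : ∀ k → 6 * length (increasingTriples k) + 3 * (k * k) ≡ k * k * k + 2 * k
length-increasingTriples zero    = refl
length-increasingTriples (suc k) = +-cancelʳ-≡ (3 * k) _ _ (begin
  6 * length (increasingTriples k ++ map (λ (a , b) → a , b , k) (increasingPairs k)) + 3 * (suc k * suc k) + 3 * k
    ≡⟨ cong (λ l → 6 * l + 3 * (suc k * suc k) + 3 * k)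
         (trans (length-++ (increasingTriples k)) (cong (t +_) (length-map _ (increasingPairs k)))) ⟩
  6 * (t + p) + 3 * (suc k * suc k) + 3 * k
    ≡⟨ regroup t p k ⟩
  (6 * t + 3 * (k * k)) + 3 * (2 * p + k) + (6 * k + 3)
    ≡⟨ cong₂ (λ a b → a + 3 * b + (6 * k + 3)) (length-increasingTriples k) (length-increasingPairs k) ⟩
  (k * k * k + 2 * k) + 3 * (k * k) + (6 * k + 3)
    ≡⟨ cube-suc k ⟩
  suc k * suc k * suc k + 2 * suc k + 3 * k ∎)
  where
  open ≡-Reasoning
  t p : ℕ
  t = length (increasingTriples k)
  p = length (increasingPairs k)
  regroup : ∀ t p k → 6 * (t + p) + 3 * (suc k * suc k) + 3 * k ≡ (6 * t + 3 * (k * k)) + 3 * (2 * p + k) + (6 * k + 3)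
  regroup = solve-∀
  cube-suc : ∀ k → (k * k * k + 2 * k) + 3 * (k * k) + (6 * k + 3) ≡ suc k * suc k * suc k + 2 * suc k + 3 * k
  cube-suc = solve-∀

nearest-sixth : ∀ n → Σ ℕ λ h → n ≤ 6 * h + 2 × 6 * h ≤ n + 3
nearest-sixth zero = 0 , z≤n , z≤n
nearest-sixth (suc n) with nearest-sixth n
... | h , n≤6h+2 , 6h≤n+3 with suc n ≤? 6 * h + 2
...   | yes 1+n≤6h+2 = h , 1+n≤6h+2 , ≤-trans 6h≤n+3 (n≤1+n (n + 3))
...   | no  1+n≰6h+2 = suc h , 1+n≤6[1+h]+2 , 6[1+h]≤1+n+3
  where
  six-suc : ∀ h → 6 * suc h ≡ suc (6 * h + 2) + 3
  six-suc = solve-∀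
  1+n≤6[1+h]+2 : suc n ≤ 6 * suc h + 2
  1+n≤6[1+h]+2 = ≤-trans (s≤s n≤6h+2) (subst (suc (6 * h + 2) ≤_) (cong (_+ 2) (sym (six-suc h)))
                   (≤-trans (m≤m+n (suc (6 * h + 2)) 3) (m≤m+n _ 2)))
  6[1+h]≤1+n+3 : 6 * suc h ≤ suc n + 3
  6[1+h]≤1+n+3 = subst (_≤ suc n + 3) (sym (six-suc h)) (+-monoˡ-≤ 3 (≰⇒> 1+n≰6h+2))

5h<n : ∀ {n h} → 16 ≤ n → 6 * h ≤ n + 3 → 5 * h < n
5h<n {n} {h} 16≤n 6h≤n+3 = *-cancelˡ-< 6 (5 * h) n (begin-strict
  6 * (5 * h)   ≡⟨ swap-factors h ⟩
  5 * (6 * h)   ≤⟨ *-monoʳ-≤ 5 6h≤n+3 ⟩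
  5 * (n + 3)   ≡⟨ expand n ⟩
  5 * n + 15    <⟨ +-monoʳ-< (5 * n) 16≤n ⟩
  5 * n + n     ≡⟨ six-n n ⟩
  6 * n         ∎)
  where
  open ≤-Reasoning
  swap-factors : ∀ h → 6 * (5 * h) ≡ 5 * (6 * h)
  swap-factors = solve-∀
  expand : ∀ n → 5 * (n + 3) ≡ 5 * n + 15
  expand = solve-∀
  six-n : ∀ n → 5 * n + n ≡ 6 * n
  six-n = solve-∀

lower-bound-arith : ∀ {n t k} → 0 < n → 6 * t + 3 * (n * n) ≡ n * n * n + 2 * n → t ≤ k * (n + n) →
                    n * n ≤ 12 * k + 3 * n
lower-bound-arith {n} {t} {k} n>0 count t≤ = *-cancelˡ-≤ n {{>-nonZero n>0}} (begin
  n * (n * n)                       ≡⟨ cube n ⟩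
  n * n * n                         ≤⟨ m≤m+n (n * n * n) (2 * n) ⟩
  n * n * n + 2 * n                 ≡⟨ count ⟨
  6 * t + 3 * (n * n)               ≤⟨ +-monoˡ-≤ (3 * (n * n)) (*-monoʳ-≤ 6 t≤) ⟩
  6 * (k * (n + n)) + 3 * (n * n)   ≡⟨ factor k n ⟩
  n * (12 * k + 3 * n)              ∎)
  where
  open ≤-Reasoning
  cube : ∀ n → n * (n * n) ≡ n * n * n
  cube = solve-∀
  factor : ∀ k n → 6 * (k * (n + n)) + 3 * (n * n) ≡ n * (12 * k + 3 * n)
  factor = solve-∀

upper-bound-arith : ∀ {n h k} → k ≤ n * suc h → 6 * h ≤ n + 3 → 24 * k ≤ 5 * (n * n) + 36 * n
upper-bound-arith {n} {h} {k} k≤ 6h≤n+3 = begin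
  24 * k                        ≤⟨ *-monoʳ-≤ 24 k≤ ⟩
  24 * (n * suc h)              ≡⟨ regroup n h ⟩
  4 * n * (6 * h) + 24 * n      ≤⟨ +-monoˡ-≤ (24 * n) (*-monoʳ-≤ (4 * n) 6h≤n+3) ⟩
  4 * n * (n + 3) + 24 * n      ≡⟨ expand n ⟩
  4 * (n * n) + 36 * n          ≤⟨ +-monoˡ-≤ (36 * n) (*-monoˡ-≤ (n * n) (n≤1+n 4)) ⟩
  5 * (n * n) + 36 * n          ∎
  where
  open ≤-Reasoning
  regroup : ∀ n h → 24 * (n * suc h) ≡ 4 * n * (6 * h) + 24 * n
  regroup = solve-∀
  expand : ∀ n → 4 * n * (n + 3) + 24 * n ≡ 4 * (n * n) + 36 * n
  expand = solve-∀

sum-of-complements : ∀ {a b c m} → a + b + c ≡ m → (m ∸ a) + ((m ∸ b) + (m ∸ c)) ≡ m + m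
sum-of-complements {a} {b} {c} {m} sum = +-cancelʳ-≡ m _ _ (begin
  (m ∸ a) + ((m ∸ b) + (m ∸ c)) + m              ≡⟨ cong ((m ∸ a) + ((m ∸ b) + (m ∸ c)) +_) sum ⟨
  (m ∸ a) + ((m ∸ b) + (m ∸ c)) + (a + b + c)    ≡⟨ regroup (m ∸ a) (m ∸ b) (m ∸ c) a b c ⟩
  (m ∸ a + a) + (m ∸ b + b) + (m ∸ c + c)
    ≡⟨ cong₂ _+_ (cong₂ _+_ (m∸n+n≡m a≤m) (m∸n+n≡m b≤m)) (m∸n+n≡m c≤m) ⟩
  m + m + m                                      ∎)
  where
  open ≡-Reasoning
  regroup : ∀ X Y Z a b c → X + (Y + Z) + (a + b + c) ≡ (X + a) + (Y + b) + (Z + c)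
  regroup = solve-∀
  a≤m : a ≤ m
  a≤m = subst (a ≤_) sum (≤-trans (m≤m+n a b) (m≤m+n (a + b) c))
  b≤m : b ≤ m
  b≤m = subst (b ≤_) sum (≤-trans (m≤n+m b a) (m≤m+n (a + b) c))
  c≤m : c ≤ m
  c≤m = subst (c ≤_) sum (m≤n+m c (a + b))

-- The cycle Ω_n

module Cycle (n : ℕ) where

  δ : Fin n → Fin n → ℕ
  δ x y with toℕ x ≤? toℕ y
  ... | yes _ = toℕ y ∸ toℕ x
  ... | no  _ = n ∸ toℕ x + toℕ y

  δ-forward : ∀ {x y} → toℕ x ≤ toℕ y → δ x y + toℕ x ≡ toℕ y
  δ-forward {x} {y} x≤y with toℕ x ≤? toℕ y
  ... | yes _   = m∸n+n≡m x≤y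
  ... | no  x≰y = contradiction x≤y x≰y

  δ-wrap : ∀ {x y} → y ≺ x → δ x y + toℕ x ≡ n + toℕ y
  δ-wrap {x} {y} y<x with toℕ x ≤? toℕ y
  ... | yes x≤y = contradiction x≤y (<⇒≱ y<x)
  ... | no  _   = begin
    n ∸ toℕ x + toℕ y + toℕ x   ≡⟨ swap-last (n ∸ toℕ x) (toℕ y) (toℕ x) ⟩
    n ∸ toℕ x + toℕ x + toℕ y   ≡⟨ cong (_+ toℕ y) (m∸n+n≡m (<⇒≤ (Fin.toℕ<n x))) ⟩
    n + toℕ y                   ∎
    where
    open ≡-Reasoning
    swap-last : ∀ a b c → a + b + c ≡ a + c + b
    swap-last = solve-∀

  data DistView (x y : Fin n) : Set where
    forward : toℕ x ≤ toℕ y → δ x y + toℕ x ≡ toℕ y     → DistView x y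
    wrap    : y ≺ x         → δ x y + toℕ x ≡ n + toℕ y → DistView x y

  distView : ∀ x y → DistView x y
  distView x y with toℕ x ≤? toℕ y
  ... | yes x≤y = forward x≤y (δ-forward x≤y)
  ... | no  x≰y = wrap (≰⇒> x≰y) (δ-wrap (≰⇒> x≰y))

  δ<n : ∀ x y → δ x y < n
  δ<n x y with distView x y
  ... | forward _ e = ≤-<-trans (m≤m+n (δ x y) (toℕ x)) (subst (_< n) (sym e) (Fin.toℕ<n y))
  ... | wrap y<x e  = +-cancelʳ-< (toℕ x) (δ x y) n (subst (_< n + toℕ x) (sym e) (+-monoʳ-< n y<x))

  δ-injectiveʳ : ∀ {x y z} → δ x y ≡ δ x z → y ≡ z
  δ-injectiveʳ {x} {y} {z} eq with distView x y | distView x z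
  ... | forward _ e₁ | forward _ e₂ = Fin.toℕ-injective (trans (sym e₁) (trans (cong (_+ toℕ x) eq) e₂))
  ... | wrap _ e₁    | wrap _ e₂    =
    Fin.toℕ-injective (+-cancelˡ-≡ n (toℕ y) (toℕ z) (trans (sym e₁) (trans (cong (_+ toℕ x) eq) e₂)))
  ... | forward _ e₁ | wrap _ e₂    = contradiction (Fin.toℕ<n y)
    (≤⇒≯ (subst (n ≤_) (trans (sym e₂) (trans (cong (_+ toℕ x) (sym eq)) e₁)) (m≤m+n n (toℕ z))))
  ... | wrap _ e₁    | forward _ e₂ = contradiction (Fin.toℕ<n z)
    (≤⇒≯ (subst (n ≤_) (trans (sym e₁) (trans (cong (_+ toℕ x) eq) e₂)) (m≤m+n n (toℕ y))))

  δ≢0 : ∀ {x y} → x ≢ y → 0 < δ x y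
  δ≢0 {x} {y} x≢y with distView x y
  ... | forward x≤y e = n≢0⇒n>0 λ δ≡0 → x≢y (Fin.toℕ-injective (trans (cong (_+ toℕ x) (sym δ≡0)) e))
  ... | wrap y<x e    = n≢0⇒n>0 λ δ≡0 → contradiction (Fin.toℕ<n x)
    (≤⇒≯ (subst (n ≤_) (trans (sym e) (cong (_+ toℕ x) δ≡0)) (m≤m+n n (toℕ y))))

  Cyc : Fin n → Fin n → Fin n → Set
  Cyc x y z = Sorted (x , y , z) ⊎ Sorted (y , z , x) ⊎ Sorted (z , x , y)

  Cyc-rotate : ∀ {x y z} → Cyc x y z → Cyc y z x
  Cyc-rotate (inj₁ s)        = inj₂ (inj₂ s)
  Cyc-rotate (inj₂ (inj₁ s)) = inj₁ s
  Cyc-rotate (inj₂ (inj₂ s)) = inj₂ (inj₁ s)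

  Cyc⇒≢ : ∀ {x y z} → Cyc x y z → x ≢ y
  Cyc⇒≢ (inj₁ (x<y , _))        refl = <-irrefl refl x<y
  Cyc⇒≢ (inj₂ (inj₁ (y<z , z<x))) refl = <-irrefl refl (<-trans y<z z<x)
  Cyc⇒≢ (inj₂ (inj₂ (_ , x<y)))   refl = <-irrefl refl x<y

  Cyc⇒δ>0 : ∀ {x y z} → Cyc x y z → 0 < δ x y
  Cyc⇒δ>0 = δ≢0 ∘ Cyc⇒≢

  δ₁₃>0 : ∀ {x y z} → Cyc x y z → 0 < δ x z
  δ₁₃>0 c = δ≢0 (Cyc⇒≢ (Cyc-rotate (Cyc-rotate c)) ∘ sym)

  δ-sum-Sorted : ∀ {x y z} → Sorted (x , y , z) → δ x y + δ y z + δ z x ≡ n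
  δ-sum-Sorted {x} {y} {z} (x<y , y<z) = +-cancelʳ-≡ (toℕ x) _ _ (begin
    δ x y + δ y z + δ z x + toℕ x       ≡⟨ regroup (δ x y) (δ y z) (δ z x) (toℕ x) ⟩
    δ z x + (δ y z + (δ x y + toℕ x))   ≡⟨ cong (λ t → δ z x + (δ y z + t)) (δ-forward (<⇒≤ x<y)) ⟩
    δ z x + (δ y z + toℕ y)             ≡⟨ cong (δ z x +_) (δ-forward (<⇒≤ y<z)) ⟩
    δ z x + toℕ z                       ≡⟨ δ-wrap (<-trans x<y y<z) ⟩
    n + toℕ x                           ∎)
    where
    open ≡-Reasoning
    regroup : ∀ a b c d → a + b + c + d ≡ c + (b + (a + d))
    regroup = solve-∀

  δ-sum : ∀ {x y z} → Cyc x y z → δ x y + δ y z + δ z x ≡ n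
  δ-sum {x} {y} {z} (inj₁ s)        = δ-sum-Sorted s
  δ-sum {x} {y} {z} (inj₂ (inj₁ s)) = trans (rotate (δ x y) (δ y z) (δ z x)) (δ-sum-Sorted s)
    where rotate : ∀ a b c → a + b + c ≡ b + c + a
          rotate = solve-∀
  δ-sum {x} {y} {z} (inj₂ (inj₂ s)) = trans (rotate (δ x y) (δ y z) (δ z x)) (δ-sum-Sorted s)
    where rotate : ∀ a b c → a + b + c ≡ c + a + b
          rotate = solve-∀

  δ+δ≡n-< : ∀ {x y} → x ≺ y → δ x y + δ y x ≡ n
  δ+δ≡n-< {x} {y} x<y = +-cancelʳ-≡ (toℕ x) _ _ (begin
    δ x y + δ y x + toℕ x     ≡⟨ swap-first (δ x y) (δ y x) (toℕ x) ⟩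
    δ y x + (δ x y + toℕ x)   ≡⟨ cong (δ y x +_) (δ-forward (<⇒≤ x<y)) ⟩
    δ y x + toℕ y             ≡⟨ δ-wrap x<y ⟩
    n + toℕ x                 ∎)
    where
    open ≡-Reasoning
    swap-first : ∀ a b c → a + b + c ≡ b + (a + c)
    swap-first = solve-∀

  δ+δ≡n : ∀ {x y} → x ≢ y → δ x y + δ y x ≡ n
  δ+δ≡n {x} {y} x≢y with Fin.<-cmp x y
  ... | tri< x<y _ _ = δ+δ≡n-< x<y
  ... | tri≈ _ x≡y _ = contradiction x≡y x≢y
  ... | tri> _ _ y<x = trans (+-comm (δ x y) (δ y x)) (δ+δ≡n-< y<x)

  δ-additive : ∀ {x y z} → Cyc x y z → δ x z ≡ δ x y + δ y z
  δ-additive {x} {y} {z} c = +-cancelʳ-≡ (δ z x) _ _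
    (trans (δ+δ≡n (Cyc⇒≢ (Cyc-rotate (Cyc-rotate c)) ∘ sym)) (sym (δ-sum c)))

  δ<δ⇒Cyc : ∀ {x y z} → 0 < δ x y → δ x y < δ x z → Cyc x y z
  δ<δ⇒Cyc {x} {y} {z} δxy>0 δxy<δxz with distView x y | distView x z
  ... | forward _ e₁ | forward _ e₂ =
    inj₁ (x<y , subst₂ _<_ e₁ e₂ (+-monoˡ-< (toℕ x) δxy<δxz))
    where x<y = subst (toℕ x <_) e₁ (+-monoˡ-≤ (toℕ x) δxy>0)
  ... | forward _ e₁ | wrap z<x _ =
    inj₂ (inj₂ (z<x , subst (toℕ x <_) e₁ (+-monoˡ-≤ (toℕ x) δxy>0)))
  ... | wrap _ e₁ | forward _ e₂ = contradiction (+-monoˡ-< (toℕ x) δxy<δxz)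
    (<⇒≯ (subst₂ _<_ (sym e₂) (sym e₁) (<-≤-trans (Fin.toℕ<n z) (m≤m+n n (toℕ y)))))
  ... | wrap y<x e₁ | wrap z<x e₂ =
    inj₂ (inj₁ (+-cancelˡ-< n (toℕ y) (toℕ z) (subst₂ _<_ e₁ e₂ (+-monoˡ-< (toℕ x) δxy<δxz)) , z<x))

  -- The vertex m steps forward from x; the final clause is junk, never reached when m < n.
  _⊕_ : Fin n → ℕ → Fin n
  x ⊕ m with toℕ x + m <? n
  ... | yes x+m<n = fromℕ< x+m<n
  ... | no  _ with toℕ x + m ∸ n <? n
  ...   | yes x+m∸n<n = fromℕ< x+m∸n<n
  ...   | no  _       = x

  δ-⊕ : ∀ x {m} → m < n → δ x (x ⊕ m) ≡ m
  δ-⊕ x {m} m<n with toℕ x + m <? n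
  ... | yes x+m<n = +-cancelʳ-≡ (toℕ x) _ m (begin
    δ x (fromℕ< x+m<n) + toℕ x
      ≡⟨ δ-forward (subst (toℕ x ≤_) (sym (Fin.toℕ-fromℕ< x+m<n)) (m≤m+n (toℕ x) m)) ⟩
    toℕ (fromℕ< x+m<n)           ≡⟨ Fin.toℕ-fromℕ< x+m<n ⟩
    toℕ x + m                    ≡⟨ +-comm (toℕ x) m ⟩
    m + toℕ x                    ∎)
    where open ≡-Reasoning
  ... | no x+m≮n with toℕ x + m ∸ n <? n
  ...   | yes x+m∸n<n = +-cancelʳ-≡ (toℕ x) _ m (begin
    δ x (fromℕ< x+m∸n<n) + toℕ x   ≡⟨ δ-wrap wraps ⟩
    n + toℕ (fromℕ< x+m∸n<n)       ≡⟨ cong (n +_) (Fin.toℕ-fromℕ< x+m∸n<n) ⟩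
    n + (toℕ x + m ∸ n)            ≡⟨ m+[n∸m]≡n n≤x+m ⟩
    toℕ x + m                      ≡⟨ +-comm (toℕ x) m ⟩
    m + toℕ x                      ∎)
    where
    open ≡-Reasoning
    n≤x+m : n ≤ toℕ x + m
    n≤x+m = ≮⇒≥ x+m≮n
    wraps : fromℕ< x+m∸n<n ≺ x
    wraps = subst (_< toℕ x) (sym (Fin.toℕ-fromℕ< x+m∸n<n))
      (+-cancelʳ-< n (toℕ x + m ∸ n) (toℕ x)
        (subst (_< toℕ x + n) (sym (m∸n+n≡m n≤x+m)) (+-monoʳ-< (toℕ x) m<n)))
  ...   | no x+m∸n≮n = contradiction (+-cancelʳ-< n (toℕ x + m ∸ n) n
    (subst (_< n + n) (sym (m∸n+n≡m (≮⇒≥ x+m≮n))) (+-mono-< (Fin.toℕ<n x) m<n))) x+m∸n≮n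

  ⊕-δ : ∀ x y → x ⊕ δ x y ≡ y
  ⊕-δ x y = δ-injectiveʳ {x} (δ-⊕ x (δ<n x y))

  sort3 : Fin n → Fin n → Fin n → Triple n
  sort3 x y z with x Fin.<? y | y Fin.<? z | x Fin.<? z
  ... | yes _ | yes _ | _     = x , y , z
  ... | yes _ | no  _ | yes _ = x , z , y
  ... | yes _ | no  _ | no  _ = z , x , y
  ... | no  _ | yes _ | yes _ = y , x , z
  ... | no  _ | yes _ | no  _ = y , z , x
  ... | no  _ | no  _ | _     = z , y , x

  sort3-xyz : ∀ {x y z} → Sorted (x , y , z) → sort3 x y z ≡ (x , y , z)
  sort3-xyz {x} {y} {z} (x<y , y<z) with x Fin.<? y | y Fin.<? z | x Fin.<? z
  ... | yes _ | yes _   | _ = refl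
  ... | yes _ | no  y≮z | _ = contradiction y<z y≮z
  ... | no x≮y | _      | _ = contradiction x<y x≮y

  sort3-xzy : ∀ {x y z} → Sorted (x , z , y) → sort3 x y z ≡ (x , z , y)
  sort3-xzy {x} {y} {z} (x<z , z<y) with x Fin.<? y | y Fin.<? z | x Fin.<? z
  ... | yes _  | yes y<z | _       = contradiction z<y (<⇒≯ y<z)
  ... | yes _  | no  _   | yes _   = refl
  ... | yes _  | no  _   | no  x≮z = contradiction x<z x≮z
  ... | no x≮y | _       | _       = contradiction (<-trans x<z z<y) x≮y

  sort3-zxy : ∀ {x y z} → Sorted (z , x , y) → sort3 x y z ≡ (z , x , y)
  sort3-zxy {x} {y} {z} (z<x , x<y) with x Fin.<? y | y Fin.<? z | x Fin.<? z
  ... | yes _  | yes y<z | _     = contradiction (<-trans z<x x<y) (<⇒≯ y<z)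
  ... | yes _  | no  _   | yes x<z = contradiction z<x (<⇒≯ x<z)
  ... | yes _  | no  _   | no  _ = refl
  ... | no x≮y | _       | _     = contradiction x<y x≮y

  sort3-yxz : ∀ {x y z} → Sorted (y , x , z) → sort3 x y z ≡ (y , x , z)
  sort3-yxz {x} {y} {z} (y<x , x<z) with x Fin.<? y | y Fin.<? z | x Fin.<? z
  ... | yes x<y | _       | _       = contradiction y<x (<⇒≯ x<y)
  ... | no  _   | yes _   | yes _   = refl
  ... | no  _   | yes _   | no  x≮z = contradiction x<z x≮z
  ... | no  _   | no  y≮z | _       = contradiction (<-trans y<x x<z) y≮z

  sort3-yzx : ∀ {x y z} → Sorted (y , z , x) → sort3 x y z ≡ (y , z , x)
  sort3-yzx {x} {y} {z} (y<z , z<x) with x Fin.<? y | y Fin.<? z | x Fin.<? z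
  ... | yes x<y | _       | _       = contradiction (<-trans y<z z<x) (<⇒≯ x<y)
  ... | no  _   | yes _   | yes x<z = contradiction z<x (<⇒≯ x<z)
  ... | no  _   | yes _   | no  _   = refl
  ... | no  _   | no  y≮z | _       = contradiction y<z y≮z

  sort3-zyx : ∀ {x y z} → Sorted (z , y , x) → sort3 x y z ≡ (z , y , x)
  sort3-zyx {x} {y} {z} (z<y , y<x) with x Fin.<? y | y Fin.<? z
  ... | yes x<y | _       = contradiction y<x (<⇒≯ x<y)
  ... | no  _   | yes y<z = contradiction z<y (<⇒≯ y<z)
  ... | no  _   | no  _   = refl

  Rotation : Triple n → Fin n → Fin n → Fin n → Set
  Rotation t x y z = t ≡ (x , y , z) ⊎ t ≡ (y , z , x) ⊎ t ≡ (z , x , y)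

  sort3-rotation : ∀ {x y z} → Cyc x y z → Rotation (sort3 x y z) x y z
  sort3-rotation (inj₁ s)        = inj₁ (sort3-xyz s)
  sort3-rotation (inj₂ (inj₁ s)) = inj₂ (inj₁ (sort3-yzx s))
  sort3-rotation (inj₂ (inj₂ s)) = inj₂ (inj₂ (sort3-zxy s))

  sort3-Sorted : ∀ {x y z} → Cyc x y z → Sorted (sort3 x y z)
  sort3-Sorted (inj₁ s)        = subst Sorted (sym (sort3-xyz s)) s
  sort3-Sorted (inj₂ (inj₁ s)) = subst Sorted (sym (sort3-yzx s)) s
  sort3-Sorted (inj₂ (inj₂ s)) = subst Sorted (sym (sort3-zxy s)) s

  IsEdge⇒sort3∈ : ∀ {E x y z} → All Sorted E → IsEdge E x y z → sort3 x y z ∈ E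
  IsEdge⇒sort3∈ {E} E-sorted e = go e
    where
    via : ∀ {x y z t} → t ∈ E → (Sorted t → sort3 x y z ≡ t) → sort3 x y z ∈ E
    via t∈E sort≡ = subst (_∈ E) (sym (sort≡ (All.lookup E-sorted t∈E))) t∈E
    go : ∀ {x y z} → IsEdge E x y z → sort3 x y z ∈ E
    go (inj₁ t∈)                                = via t∈ sort3-xyz
    go (inj₂ (inj₁ t∈))                         = via t∈ sort3-xzy
    go (inj₂ (inj₂ (inj₁ t∈)))                  = via t∈ sort3-yxz
    go (inj₂ (inj₂ (inj₂ (inj₁ t∈))))           = via t∈ sort3-yzx
    go (inj₂ (inj₂ (inj₂ (inj₂ (inj₁ t∈)))))    = via t∈ sort3-zxy
    go (inj₂ (inj₂ (inj₂ (inj₂ (inj₂ t∈)))))    = via t∈ sort3-zyx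

  sort3∈⇒IsEdge : ∀ {E x y z} → Cyc x y z → sort3 x y z ∈ E → IsEdge E x y z
  sort3∈⇒IsEdge {E} c t∈ with sort3-rotation c
  ... | inj₁ e        = inj₁ (subst (_∈ E) e t∈)
  ... | inj₂ (inj₁ e) = inj₂ (inj₂ (inj₂ (inj₁ (subst (_∈ E) e t∈))))
  ... | inj₂ (inj₂ e) = inj₂ (inj₂ (inj₂ (inj₂ (inj₁ (subst (_∈ E) e t∈)))))

  rotation-injective₃ : ∀ {t x y z w} → x ≢ y → Rotation t x y z → Rotation t x y w → z ≡ w
  rotation-injective₃ _   (inj₁ refl)        (inj₁ refl)        = refl
  rotation-injective₃ x≢y (inj₁ refl)        (inj₂ (inj₁ refl)) = contradiction refl x≢y
  rotation-injective₃ x≢y (inj₁ refl)        (inj₂ (inj₂ refl)) = contradiction refl x≢y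
  rotation-injective₃ x≢y (inj₂ (inj₁ refl)) (inj₁ refl)        = contradiction refl x≢y
  rotation-injective₃ _   (inj₂ (inj₁ refl)) (inj₂ (inj₁ refl)) = refl
  rotation-injective₃ x≢y (inj₂ (inj₁ refl)) (inj₂ (inj₂ refl)) = contradiction refl x≢y
  rotation-injective₃ x≢y (inj₂ (inj₂ refl)) (inj₁ refl)        = contradiction refl x≢y
  rotation-injective₃ x≢y (inj₂ (inj₂ refl)) (inj₂ (inj₁ refl)) = contradiction refl x≢y
  rotation-injective₃ _   (inj₂ (inj₂ refl)) (inj₂ (inj₂ refl)) = refl

  sort3-injective₃ : ∀ {x y z w} → Cyc x y z → Cyc x y w → sort3 x y z ≡ sort3 x y w → z ≡ w
  sort3-injective₃ {x} {y} {w = w} c c′ eq = rotation-injective₃ (Cyc⇒≢ c) (sort3-rotation c)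
    (subst (λ t → Rotation t x y w) (sym eq) (sort3-rotation c′))

  CycOrd4⇒Cyc : ∀ {x₀ x₁ x₂ x₃} → CycOrd4 x₀ x₁ x₂ x₃ →
                Cyc x₀ x₁ x₂ × Cyc x₀ x₁ x₃ × Cyc x₀ x₂ x₃
  CycOrd4⇒Cyc (inj₁ (a , b , c)) =
    inj₁ (a , b) , inj₁ (a , <-trans b c) , inj₁ (<-trans a b , c)
  CycOrd4⇒Cyc (inj₂ (inj₁ (a , b , c))) =
    inj₂ (inj₁ (a , <-trans b c)) , inj₂ (inj₁ (<-trans a b , c)) , inj₂ (inj₁ (b , c))
  CycOrd4⇒Cyc (inj₂ (inj₂ (inj₁ (a , b , c)))) =
    inj₂ (inj₂ (<-trans a b , c)) , inj₂ (inj₂ (b , c)) , inj₂ (inj₁ (a , b))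
  CycOrd4⇒Cyc (inj₂ (inj₂ (inj₂ (a , b , c)))) =
    inj₁ (b , c) , inj₂ (inj₂ (a , b)) , inj₂ (inj₂ (a , <-trans b c))

  Cyc⇒CycOrd4 : ∀ {x₀ x₁ x₂ x₃} → Cyc x₀ x₁ x₂ → Cyc x₀ x₂ x₃ → CycOrd4 x₀ x₁ x₂ x₃
  Cyc⇒CycOrd4 (inj₁ (a , b))        (inj₁ (_ , b′))        = inj₁ (a , b , b′)
  Cyc⇒CycOrd4 (inj₁ (a , b))        (inj₂ (inj₁ (a′ , b′))) = contradiction (<-trans a b) (<⇒≯ (<-trans a′ b′))
  Cyc⇒CycOrd4 (inj₁ (a , b))        (inj₂ (inj₂ (a′ , _))) = inj₂ (inj₂ (inj₂ (a′ , a , b)))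
  Cyc⇒CycOrd4 (inj₂ (inj₁ (_ , b))) (inj₁ (a′ , _))        = contradiction b (<⇒≯ a′)
  Cyc⇒CycOrd4 (inj₂ (inj₁ (a , _))) (inj₂ (inj₁ (a′ , b′))) = inj₂ (inj₁ (a , a′ , b′))
  Cyc⇒CycOrd4 (inj₂ (inj₁ (_ , b))) (inj₂ (inj₂ (_ , b′))) = contradiction b (<⇒≯ b′)
  Cyc⇒CycOrd4 (inj₂ (inj₂ (a , _))) (inj₁ (a′ , _))        = contradiction a (<⇒≯ a′)
  Cyc⇒CycOrd4 (inj₂ (inj₂ (_ , b))) (inj₂ (inj₁ (a′ , b′))) = inj₂ (inj₂ (inj₁ (a′ , b′ , b)))
  Cyc⇒CycOrd4 (inj₂ (inj₂ (a , _))) (inj₂ (inj₂ (_ , b′))) = contradiction a (<⇒≯ b′)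

  shared-pair⇒ContainsD₂ : ∀ {E x y z w} → Cyc x y z → Cyc x y w → z ≢ w →
                           IsEdge E x y z → IsEdge E x y w → ContainsD₂ E
  shared-pair⇒ContainsD₂ {x = x} {y} {z} {w} c c′ z≢w e e′ with <-cmp (δ x z) (δ x w)
  ... | tri< δxz<δxw _ _ = x , y , z , w , Cyc⇒CycOrd4 c (δ<δ⇒Cyc (δ₁₃>0 c) δxz<δxw) , e , e′
  ... | tri≈ _ δxz≡δxw _ = contradiction (δ-injectiveʳ {x} δxz≡δxw) z≢w
  ... | tri> _ _ δxw<δxz = x , y , w , z , Cyc⇒CycOrd4 c′ (δ<δ⇒Cyc (δ₁₃>0 c′) δxw<δxz) , e′ , e

  Sorted? : Decidable (Sorted {n})
  Sorted? (a , b , c) = (a Fin.<? b) ×-dec (b Fin.<? c)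

  allTriples : List (Triple n)
  allTriples = cartesianProduct (allFin n) (cartesianProduct (allFin n) (allFin n))

  sortedTriples : List (Triple n)
  sortedTriples = filter Sorted? allTriples

  sortedTriples-Unique : Unique sortedTriples
  sortedTriples-Unique = Unique.filter⁺ Sorted?
    (Unique.cartesianProduct⁺ (Unique.allFin⁺ n) (Unique.cartesianProduct⁺ (Unique.allFin⁺ n) (Unique.allFin⁺ n)))

  ∈-sortedTriples⁺ : ∀ {t} → Sorted t → t ∈ sortedTriples
  ∈-sortedTriples⁺ {a , b , c} s =
    ∈-filter⁺ Sorted? (∈-cartesianProduct⁺ (∈-allFin a) (∈-cartesianProduct⁺ (∈-allFin b) (∈-allFin c))) s

  ∈-sortedTriples⁻ : ∀ {t} → t ∈ sortedTriples → Sorted t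
  ∈-sortedTriples⁻ = proj₂ ∘ ∈-filter⁻ Sorted? {xs = allTriples}

  _≟ₜ_ : (s t : Triple n) → Dec (s ≡ t)
  _≟ₜ_ = ≡-dec Fin._≟_ (≡-dec Fin._≟_ Fin._≟_)

  open import Data.List.Membership.DecPropositional _≟ₜ_ using (_∈?_)

  -- D₂-Saturated H unfolds to Saturated (edges H).
  Saturated : List (Triple n) → Set
  Saturated E = ¬ ContainsD₂ E × (∀ e → Sorted e → e ∉ E → ContainsD₂ (e ∷ E))

  CycOrd4? : ∀ (x₀ x₁ x₂ x₃ : Fin n) → Dec (CycOrd4 x₀ x₁ x₂ x₃)
  CycOrd4? x₀ x₁ x₂ x₃ =
    ((x₀ Fin.<? x₁) ×-dec (x₁ Fin.<? x₂) ×-dec (x₂ Fin.<? x₃)) ⊎-dec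
    ((x₁ Fin.<? x₂) ×-dec (x₂ Fin.<? x₃) ×-dec (x₃ Fin.<? x₀)) ⊎-dec
    ((x₂ Fin.<? x₃) ×-dec (x₃ Fin.<? x₀) ×-dec (x₀ Fin.<? x₁)) ⊎-dec
    ((x₃ Fin.<? x₀) ×-dec (x₀ Fin.<? x₁) ×-dec (x₁ Fin.<? x₂))

  IsEdge? : ∀ (E : List (Triple n)) x y z → Dec (IsEdge E x y z)
  IsEdge? E x y z = ((x , y , z) ∈? E) ⊎-dec ((x , z , y) ∈? E) ⊎-dec ((y , x , z) ∈? E) ⊎-dec
                    ((y , z , x) ∈? E) ⊎-dec ((z , x , y) ∈? E) ⊎-dec ((z , y , x) ∈? E)

  ContainsD₂? : ∀ (E : List (Triple n)) → Dec (ContainsD₂ E)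
  ContainsD₂? E = Fin.any? λ x₀ → Fin.any? λ x₁ → Fin.any? λ x₂ → Fin.any? λ x₃ →
    CycOrd4? x₀ x₁ x₂ x₃ ×-dec IsEdge? E x₀ x₁ x₂ ×-dec IsEdge? E x₀ x₁ x₃

  Saturated? : Decidable Saturated
  Saturated? E = ¬? (ContainsD₂? E) ×-dec map′ (λ f (a , b , c) → f a b c) (λ g a b c → g (a , b , c))
    (Fin.all? λ a → Fin.all? λ b → Fin.all? λ c →
      Sorted? (a , b , c) →-dec ¬? ((a , b , c) ∈? E) →-dec ContainsD₂? ((a , b , c) ∷ E))

  IsEdge-mono : ∀ {E F : List (Triple n)} {x y z} → E ⊆ F → IsEdge E x y z → IsEdge F x y z
  IsEdge-mono E⊆F = Sum.map E⊆F (Sum.map E⊆F (Sum.map E⊆F (Sum.map E⊆F (Sum.map E⊆F E⊆F))))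

  ContainsD₂-mono : ∀ {E F : List (Triple n)} → E ⊆ F → ContainsD₂ E → ContainsD₂ F
  ContainsD₂-mono E⊆F (x₀ , x₁ , x₂ , x₃ , ord , e₂ , e₃) =
    x₀ , x₁ , x₂ , x₃ , ord , IsEdge-mono E⊆F e₂ , IsEdge-mono E⊆F e₃

  Saturated-cong : ∀ {E F : List (Triple n)} → E ⊆ F → F ⊆ E → Saturated E → Saturated F
  Saturated-cong E⊆F F⊆E (D₂-free , saturating) =
    D₂-free ∘ ContainsD₂-mono F⊆E ,
    λ e s e∉F → ContainsD₂-mono (∷⁺ʳ e E⊆F) (saturating e s (e∉F ∘ E⊆F))

  -- Sorting and deduplicating an edge list keeps saturation and does not lengthen it, so the
  -- minimum can be taken over the finitely many sublists of sortedTriples.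
  canonical : List (Triple n) → List (Triple n)
  canonical E = filter (_∈? E) sortedTriples

  canonical⊆ : ∀ E → canonical E ⊆ E
  canonical⊆ E = proj₂ ∘ ∈-filter⁻ (_∈? E) {xs = sortedTriples}

  ⊆canonical : ∀ {E} → All Sorted E → E ⊆ canonical E
  ⊆canonical {E} E-Sorted t∈E = ∈-filter⁺ (_∈? E) (∈-sortedTriples⁺ (All.lookup E-Sorted t∈E)) t∈E

  length-canonical : ∀ E → length (canonical E) ≤ length E
  length-canonical E = Unique⇒length≤ (Unique.filter⁺ (_∈? E) sortedTriples-Unique) (canonical⊆ E)

  sat-attained : (H : CGH n) → D₂-Saturated H → Σ ℕ λ k → IsSatD₂ n k × k ≤ ∣ H ∣ₑ
  sat-attained H H-saturated =
    length E* , ((cgh E* E*-Sorted E*-Unique , E*-Saturated , refl) , minimal) ,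
    ≤-trans (f[argmin]≤f[⊤] {f = length} E₀ candidates) (length-canonical (edges H))
    where
    Candidate : List (Triple n) → Set
    Candidate E = E ∈ sublists sortedTriples × Saturated E

    candidates : List (List (Triple n))
    candidates = filter Saturated? (sublists sortedTriples)

    canonical-Candidate : (G : CGH n) → D₂-Saturated G → Candidate (canonical (edges G))
    canonical-Candidate G G-saturated = filter∈sublists (_∈? edges G) sortedTriples ,
      Saturated-cong (⊆canonical (sorted G)) (canonical⊆ (edges G)) G-saturated

    E₀ E* : List (Triple n)
    E₀ = canonical (edges H)
    E* = argmin length E₀ candidates

    E*-Candidate : Candidate E*
    E*-Candidate = argmin-all length (canonical-Candidate H H-saturated) (All.tabulate (∈-filter⁻ Saturated?))

    E*-Saturated : Saturated E*
    E*-Saturated = proj₂ E*-Candidate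

    E*-Sorted : All Sorted E*
    E*-Sorted = anti-mono (∈-sublists⇒⊆ sortedTriples (proj₁ E*-Candidate)) (All.tabulate ∈-sortedTriples⁻)
    E*-Unique : Unique E*
    E*-Unique = ∈-sublists⇒Unique sortedTriples-Unique (proj₁ E*-Candidate)

    minimal : ∀ G → D₂-Saturated G → length E* ≤ ∣ G ∣ₑ
    minimal G G-saturated = ≤-trans
      (All.lookup (f[argmin]≤f[xs] {f = length} E₀ candidates)
        (uncurry (∈-filter⁺ Saturated?) (canonical-Candidate G G-saturated)))
      (length-canonical (edges G))

  -- The lower bound

  toℕ³ : Triple n → ℕ × ℕ × ℕ
  toℕ³ (a , b , c) = toℕ a , toℕ b , toℕ c

  beyond : ℕ → List ℕ
  beyond d = map (λ i → suc (d + i)) (upTo (n ∸ suc d))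

  ∈-beyond⁺ : ∀ {d m} → d < m → m < n → m ∈ beyond d
  ∈-beyond⁺ {d} {m} d<m m<n = subst (_∈ beyond d) (m+[n∸m]≡n d<m)
    (∈-map⁺ (λ i → suc (d + i)) (∈-upTo⁺ (∸-monoˡ-< m<n d<m)))

  -- The triples {p, q, v} with v on the open arc from q forward to p, as ℕ-triples so that they
  -- can be compared with increasingTriples n.
  arcShadow : Fin n → Fin n → List (ℕ × ℕ × ℕ)
  arcShadow p q = map (λ m → toℕ³ (sort3 p q (p ⊕ m))) (beyond (δ p q))

  shadow : Triple n → List (ℕ × ℕ × ℕ)
  shadow (a , b , c) = arcShadow a b ++ arcShadow b c ++ arcShadow c a

  shadows : List (Triple n) → List (ℕ × ℕ × ℕ)
  shadows = concatMap shadow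

  ∈-arcShadow⁺ : ∀ {x y z} → Cyc x y z → toℕ³ (sort3 x y z) ∈ arcShadow x y
  ∈-arcShadow⁺ {x} {y} {z} c = subst (λ v → toℕ³ (sort3 x y v) ∈ arcShadow x y) (⊕-δ x z)
    (∈-map⁺ (λ m → toℕ³ (sort3 x y (x ⊕ m))) (∈-beyond⁺ δxy<δxz (δ<n x z)))
    where
    δxy<δxz : δ x y < δ x z
    δxy<δxz = subst (δ x y <_) (sym (δ-additive c)) (m<m+n (δ x y) (Cyc⇒δ>0 (Cyc-rotate c)))

  arcShadow⊆shadow : ∀ {t x y w} → Rotation t x y w → arcShadow x y ⊆ shadow t
  arcShadow⊆shadow                 (inj₁ refl)        = ∈-++⁺ˡ
  arcShadow⊆shadow {y = y} {w}     (inj₂ (inj₁ refl)) = ∈-++⁺ʳ (arcShadow y w) ∘ ∈-++⁺ʳ (arcShadow w _)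
  arcShadow⊆shadow {x = x} {w = w} (inj₂ (inj₂ refl)) = ∈-++⁺ʳ (arcShadow w x) ∘ ∈-++⁺ˡ

  length-shadow : ∀ {t} → Sorted t → length (shadow t) ≤ n + n
  length-shadow {a , b , c} s = begin
    length (arcShadow a b ++ arcShadow b c ++ arcShadow c a)
      ≡⟨ trans (length-++ (arcShadow a b)) (cong (length (arcShadow a b) +_) (length-++ (arcShadow b c))) ⟩
    length (arcShadow a b) + (length (arcShadow b c) + length (arcShadow c a))
      ≡⟨ cong₂ _+_ (length-arcShadow a b) (cong₂ _+_ (length-arcShadow b c) (length-arcShadow c a)) ⟩
    (n ∸ suc (δ a b)) + ((n ∸ suc (δ b c)) + (n ∸ suc (δ c a)))
      ≤⟨ +-mono-≤ (shrink (δ a b)) (+-mono-≤ (shrink (δ b c)) (shrink (δ c a))) ⟩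
    (n ∸ δ a b) + ((n ∸ δ b c) + (n ∸ δ c a))
      ≡⟨ sum-of-complements {δ a b} {δ b c} (δ-sum (inj₁ s)) ⟩
    n + n ∎
    where
    open ≤-Reasoning
    length-arcShadow : ∀ p q → length (arcShadow p q) ≡ n ∸ suc (δ p q)
    length-arcShadow p q = trans (length-map _ (beyond (δ p q)))
      (trans (length-map _ (upTo (n ∸ suc (δ p q)))) (length-upTo (n ∸ suc (δ p q))))
    shrink : ∀ d → n ∸ suc d ≤ n ∸ d
    shrink d = ∸-monoʳ-≤ n (n≤1+n d)

  module _ {E : List (Triple n)} (E-Sorted : All Sorted E) (E-Saturated : Saturated E) where

    shadowed : ∀ {x y z w} → Cyc x y z → Cyc x y w → sort3 x y w ∈ E → toℕ³ (sort3 x y z) ∈ shadows E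
    shadowed c c′ f∈E = ∈-concatMap⁺ shadow (lose f∈E (arcShadow⊆shadow (sort3-rotation c′) (∈-arcShadow⁺ c)))

    Sorted⇒shadowed : ∀ {t} → Sorted t → toℕ³ t ∈ shadows E
    Sorted⇒shadowed {t} s with t ∈? E
    ... | yes t∈E = subst (λ u → toℕ³ u ∈ shadows E) (sort3-xyz s)
                      (shadowed (inj₁ s) (inj₁ s) (subst (_∈ E) (sym (sort3-xyz s)) t∈E))
    ... | no t∉E with proj₂ E-Saturated t s t∉E
    ...   | x₀ , x₁ , x₂ , x₃ , ord , e₂ , e₃ with CycOrd4⇒Cyc ord
    ...     | c₀₁₂ , c₀₁₃ , c₀₂₃
            with IsEdge⇒sort3∈ (s ∷ E-Sorted) e₂ | IsEdge⇒sort3∈ (s ∷ E-Sorted) e₃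
    ...       | here t₂≡t  | here t₃≡t  =
      ⊥-elim (Cyc⇒≢ (Cyc-rotate c₀₂₃) (sort3-injective₃ c₀₁₂ c₀₁₃ (trans t₂≡t (sym t₃≡t))))
    ...       | here t₂≡t  | there t₃∈E =
      subst (λ u → toℕ³ u ∈ shadows E) t₂≡t (shadowed c₀₁₂ c₀₁₃ t₃∈E)
    ...       | there t₂∈E | here t₃≡t  =
      subst (λ u → toℕ³ u ∈ shadows E) t₃≡t (shadowed c₀₁₃ c₀₁₂ t₂∈E)
    ...       | there t₂∈E | there t₃∈E =
      ⊥-elim (proj₁ E-Saturated
        (x₀ , x₁ , x₂ , x₃ , ord , sort3∈⇒IsEdge c₀₁₂ t₂∈E , sort3∈⇒IsEdge c₀₁₃ t₃∈E))

    increasingTriples⊆shadows : increasingTriples n ⊆ shadows E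
    increasingTriples⊆shadows {a , b , c} abc∈ with ∈-increasingTriples⁻ n abc∈
    ... | a<b , b<c , c<n = subst (_∈ shadows E) toℕ³-T (Sorted⇒shadowed sorted-T)
      where
      a<n : a < n
      a<n = <-trans a<b (<-trans b<c c<n)
      b<n : b < n
      b<n = <-trans b<c c<n
      toℕ³-T : toℕ³ (fromℕ< a<n , fromℕ< b<n , fromℕ< c<n) ≡ (a , b , c)
      toℕ³-T = cong₂ _,_ (Fin.toℕ-fromℕ< a<n) (cong₂ _,_ (Fin.toℕ-fromℕ< b<n) (Fin.toℕ-fromℕ< c<n))
      sorted-T : Sorted (fromℕ< a<n , fromℕ< b<n , fromℕ< c<n)
      sorted-T = subst₂ _<_ (sym (Fin.toℕ-fromℕ< a<n)) (sym (Fin.toℕ-fromℕ< b<n)) a<b ,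
                 subst₂ _<_ (sym (Fin.toℕ-fromℕ< b<n)) (sym (Fin.toℕ-fromℕ< c<n)) b<c

    triples≤shadows : length (increasingTriples n) ≤ length E * (n + n)
    triples≤shadows = begin
      length (increasingTriples n)  ≤⟨ Unique⇒length≤ (increasingTriples-Unique n) increasingTriples⊆shadows ⟩
      length (shadows E)            ≤⟨ length-concatMap-≤ shadow E (length-shadow ∘ All.lookup E-Sorted) ⟩
      length E * (n + n)            ∎
      where open ≤-Reasoning

  IsSatD₂⇒triples≤ : ∀ {k} → IsSatD₂ n k → length (increasingTriples n) ≤ k * (n + n)
  IsSatD₂⇒triples≤ ((H , H-saturated , refl) , _) = triples≤shadows (sorted H) H-saturated

  -- The construction for the upper bound

  module Construction (h : ℕ) (5h<n : 5 * h < n) where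

    Step : ℕ → ℕ → Set
    Step d e = 1 ≤ d × d ≤ h × e ≡ d + h

    Pattern : ℕ → ℕ → ℕ → Set
    Pattern a b c = Step a b ⊎ Step b c ⊎ Step c a

    Pattern-rotate : ∀ {a b c} → Pattern a b c → Pattern b c a
    Pattern-rotate (inj₁ p)        = inj₂ (inj₂ p)
    Pattern-rotate (inj₂ (inj₁ p)) = inj₁ p
    Pattern-rotate (inj₂ (inj₂ p)) = inj₂ (inj₁ p)

    Patterned : Triple n → Set
    Patterned (a , b , c) = Pattern (δ a b) (δ b c) (δ c a)

    Patterned? : Decidable Patterned
    Patterned? (a , b , c) = step? (δ a b) (δ b c) ⊎-dec step? (δ b c) (δ c a) ⊎-dec step? (δ c a) (δ a b)
      where
      step? : ∀ d e → Dec (Step d e)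
      step? d e = (1 ≤? d) ×-dec (d ≤? h) ×-dec (e ≟ d + h)

    H₀ : List (Triple n)
    H₀ = filter Patterned? sortedTriples

    H₀-Sorted : All Sorted H₀
    H₀-Sorted = All.tabulate (∈-sortedTriples⁻ ∘ proj₁ ∘ ∈-filter⁻ Patterned? {xs = sortedTriples})

    H₀-Unique : Unique H₀
    H₀-Unique = Unique.filter⁺ Patterned? sortedTriples-Unique

    Patterned-rotation⁻ : ∀ {t x y z} → Rotation t x y z → Patterned t → Pattern (δ x y) (δ y z) (δ z x)
    Patterned-rotation⁻ (inj₁ refl)        p = p
    Patterned-rotation⁻ (inj₂ (inj₁ refl)) p = Pattern-rotate (Pattern-rotate p)
    Patterned-rotation⁻ (inj₂ (inj₂ refl)) p = Pattern-rotate p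

    Patterned-rotation⁺ : ∀ {t x y z} → Rotation t x y z → Pattern (δ x y) (δ y z) (δ z x) → Patterned t
    Patterned-rotation⁺ (inj₁ refl)        p = p
    Patterned-rotation⁺ (inj₂ (inj₁ refl)) p = Pattern-rotate p
    Patterned-rotation⁺ (inj₂ (inj₂ refl)) p = Pattern-rotate (Pattern-rotate p)

    ∈-H₀⁻ : ∀ {x y z} → Cyc x y z → sort3 x y z ∈ H₀ → Pattern (δ x y) (δ y z) (δ z x)
    ∈-H₀⁻ c t∈ = Patterned-rotation⁻ (sort3-rotation c) (proj₂ (∈-filter⁻ Patterned? {xs = sortedTriples} t∈))

    ∈-H₀⁺ : ∀ {x y z} → Cyc x y z → Pattern (δ x y) (δ y z) (δ z x) → sort3 x y z ∈ H₀
    ∈-H₀⁺ c p = ∈-filter⁺ Patterned? (∈-sortedTriples⁺ (sort3-Sorted c)) (Patterned-rotation⁺ (sort3-rotation c) p)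

    Step-first≤h : ∀ {d e} → Step d e → d ≤ h
    Step-first≤h (_ , d≤h , _) = d≤h

    Step-second≤2h : ∀ {d e} → Step d e → e ≤ h + h
    Step-second≤2h (_ , d≤h , refl) = +-monoˡ-≤ h d≤h

    ¬Step-chain : ∀ {c d e} → Step c d → Step d e → ⊥
    ¬Step-chain (1≤c , _ , refl) (_ , c+h≤h , _) = <⇒≱ (+-monoˡ-≤ h 1≤c) c+h≤h

    arcs-too-short : ∀ {a b c} → a + b + c ≡ n → a ≤ h + h → b ≤ h → c ≤ h + h → ⊥
    arcs-too-short {a} {b} {c} sum a≤2h b≤h c≤2h = <⇒≱ 5h<n (begin
      n                      ≡⟨ sum ⟨
      a + b + c              ≤⟨ +-mono-≤ (+-mono-≤ a≤2h b≤h) c≤2h ⟩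
      h + h + h + (h + h)    ≡⟨ five-h h ⟩
      5 * h                  ∎)
      where
      open ≤-Reasoning
      five-h : ∀ h → h + h + h + (h + h) ≡ 5 * h
      five-h = solve-∀

    Pattern-second-unique : ∀ {d s t s′ t′} → d + s + t ≡ n → d + s′ + t′ ≡ n →
                            Pattern d s t → Pattern d s′ t′ → s ≡ s′
    Pattern-second-unique _ _ (inj₁ (_ , _ , refl)) (inj₁ (_ , _ , refl)) = refl
    Pattern-second-unique _ e′ (inj₁ (_ , d≤h , _)) (inj₂ (inj₁ s′t′)) =
      ⊥-elim (arcs-too-short e′ (≤-trans d≤h (m≤m+n h h)) (Step-first≤h s′t′) (Step-second≤2h s′t′))
    Pattern-second-unique _ _ (inj₁ ds) (inj₂ (inj₂ t′d)) = ⊥-elim (¬Step-chain t′d ds)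
    Pattern-second-unique e _ (inj₂ (inj₁ st)) (inj₁ (_ , d≤h , _)) =
      ⊥-elim (arcs-too-short e (≤-trans d≤h (m≤m+n h h)) (Step-first≤h st) (Step-second≤2h st))
    Pattern-second-unique {d} {s} {s′ = s′} e e′ (inj₂ (inj₁ (_ , _ , refl))) (inj₂ (inj₁ (_ , _ , refl)))
      with <-cmp s s′
    ... | tri< s<s′ _ _ = contradiction (trans e (sym e′))
                            (<⇒≢ (+-mono-< (+-monoʳ-< d s<s′) (+-monoˡ-< h s<s′)))
    ... | tri≈ _ s≡s′ _ = s≡s′
    ... | tri> _ _ s′<s = contradiction (trans e′ (sym e))
                            (<⇒≢ (+-mono-< (+-monoʳ-< d s′<s) (+-monoˡ-< h s′<s)))
    Pattern-second-unique e _ (inj₂ (inj₁ st)) (inj₂ (inj₂ t′d)) =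
      ⊥-elim (arcs-too-short e (Step-second≤2h t′d) (Step-first≤h st) (Step-second≤2h st))
    Pattern-second-unique _ _ (inj₂ (inj₂ td)) (inj₁ ds′) = ⊥-elim (¬Step-chain td ds′)
    Pattern-second-unique _ e′ (inj₂ (inj₂ td)) (inj₂ (inj₁ s′t′)) =
      ⊥-elim (arcs-too-short e′ (Step-second≤2h td) (Step-first≤h s′t′) (Step-second≤2h s′t′))
    Pattern-second-unique {d} {s} {t} {s′} {t′} e e′ (inj₂ (inj₂ (_ , _ , d≡t+h))) (inj₂ (inj₂ (_ , _ , d≡t′+h))) =
      +-cancelˡ-≡ d s s′ (+-cancelʳ-≡ t (d + s) (d + s′)
        (trans e (sym (subst (λ u → d + s′ + u ≡ n) (sym t≡t′) e′))))
      where
      t≡t′ : t ≡ t′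
      t≡t′ = +-cancelʳ-≡ h t t′ (trans (sym d≡t+h) d≡t′+h)

    H₀-D₂-free : ¬ ContainsD₂ H₀
    H₀-D₂-free (x₀ , x₁ , x₂ , x₃ , ord , e₂ , e₃) with CycOrd4⇒Cyc ord
    ... | c₀₁₂ , c₀₁₃ , c₀₂₃ = Cyc⇒≢ (Cyc-rotate c₀₂₃) (δ-injectiveʳ {x₁}
          (Pattern-second-unique (δ-sum c₀₁₂) (δ-sum c₀₁₃) (edge-pattern c₀₁₂ e₂) (edge-pattern c₀₁₃ e₃)))
      where
      edge-pattern : ∀ {x y z} → Cyc x y z → IsEdge H₀ x y z → Pattern (δ x y) (δ y z) (δ z x)
      edge-pattern c e = ∈-H₀⁻ c (IsEdge⇒sort3∈ H₀-Sorted e)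

    Pattern-completion : ∀ {D} → 0 < D → D ≤ h + h →
                         Σ ℕ λ s → Σ ℕ λ j → D + s + j ≡ n × 0 < s × 0 < j × Pattern D s j
    Pattern-completion {D} D>0 D≤2h with D ≤? h
    ... | yes D≤h = D + h , n ∸ (D + (D + h)) , m+[n∸m]≡n (<⇒≤ D+s<n) , ≤-trans D>0 (m≤m+n D h) ,
                    m<n⇒0<n∸m D+s<n , inj₁ (D>0 , D≤h , refl)
      where
      D+s<n : D + (D + h) < n
      D+s<n = ≤-<-trans (+-mono-≤ D≤h (+-monoˡ-≤ h D≤h)) (≤-<-trans (three-h≤five-h h) 5h<n)
        where
        three-h≤five-h : ∀ h → h + (h + h) ≤ 5 * h
        three-h≤five-h h = subst (h + (h + h) ≤_) (add-two h) (m≤m+n (h + (h + h)) (h + h))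
          where
          add-two : ∀ h → h + (h + h) + (h + h) ≡ 5 * h
          add-two = solve-∀
    ... | no D≰h = s , j , sum , m<n⇒0<n∸m D+j<n , j>0 , inj₂ (inj₂ (j>0 , j≤h , sym (m∸n+n≡m (<⇒≤ h<D))))
      where
      h<D : h < D
      h<D = ≰⇒> D≰h
      j s : ℕ
      j = D ∸ h
      s = n ∸ (D + j)
      j>0 : 0 < j
      j>0 = m<n⇒0<n∸m h<D
      j≤h : j ≤ h
      j≤h = subst (j ≤_) (m+n∸n≡m h h) (∸-monoˡ-≤ h D≤2h)
      D+j<n : D + j < n
      D+j<n = ≤-<-trans (+-mono-≤ D≤2h j≤h) (≤-<-trans (three-h≤five-h h) 5h<n)
        where
        three-h≤five-h : ∀ h → h + h + h ≤ 5 * h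
        three-h≤five-h h = subst (h + h + h ≤_) (add-two h) (m≤m+n (h + h + h) (h + h))
          where
          add-two : ∀ h → h + h + h + (h + h) ≡ 5 * h
          add-two = solve-∀
      sum : D + s + j ≡ n
      sum = begin
        D + s + j     ≡⟨ swap-last D s j ⟩
        D + j + s     ≡⟨ m+[n∸m]≡n (<⇒≤ D+j<n) ⟩
        n             ∎
        where
        open ≡-Reasoning
        swap-last : ∀ a b c → a + b + c ≡ a + c + b
        swap-last = solve-∀

    short-arc-saturates : ∀ {x y z e} → Cyc x y z → δ x y ≤ h + h →
                          sort3 x y z ≡ e → e ∉ H₀ → ContainsD₂ (e ∷ H₀)
    short-arc-saturates {x} {y} {z} c D≤2h refl e∉H₀ with Pattern-completion (Cyc⇒δ>0 c) D≤2h
    ... | s , j , sum , s>0 , j>0 , pat =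
      shared-pair⇒ContainsD₂ c cw z≢w (sort3∈⇒IsEdge c (here refl)) (sort3∈⇒IsEdge cw (there w∈H₀))
      where
      D : ℕ
      D = δ x y
      m<n : D + s < n
      m<n = subst (D + s <_) sum (m<m+n (D + s) j>0)
      w : Fin n
      w = x ⊕ (D + s)
      δxw : δ x w ≡ D + s
      δxw = δ-⊕ x m<n
      cw : Cyc x y w
      cw = δ<δ⇒Cyc (Cyc⇒δ>0 c) (subst (D <_) (sym δxw) (m<m+n D s>0))
      δyw : δ y w ≡ s
      δyw = +-cancelˡ-≡ D _ _ (trans (sym (δ-additive cw)) δxw)
      δwx : δ w x ≡ j
      δwx = +-cancelˡ-≡ (D + s) _ _ (trans (cong (λ t → D + t + δ w x) (sym δyw)) (trans (δ-sum cw) (sym sum)))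
      w∈H₀ : sort3 x y w ∈ H₀
      w∈H₀ = ∈-H₀⁺ cw (subst₂ (Pattern D) (sym δyw) (sym δwx) pat)
      z≢w : z ≢ w
      z≢w refl = e∉H₀ w∈H₀

    H₀-saturating : n ≤ 6 * h + 2 → ∀ e → Sorted e → e ∉ H₀ → ContainsD₂ (e ∷ H₀)
    H₀-saturating n≤6h+2 (a , b , c) s e∉H₀ with δ a b ≤? h + h | δ b c ≤? h + h | δ c a ≤? h + h
    ... | yes ab≤ | _       | _       = short-arc-saturates (inj₁ s) ab≤ (sort3-xyz s) e∉H₀
    ... | no _    | yes bc≤ | _       = short-arc-saturates (Cyc-rotate (inj₁ s)) bc≤ (sort3-zxy s) e∉H₀
    ... | no _    | no _    | yes ca≤ = short-arc-saturates (Cyc-rotate (Cyc-rotate (inj₁ s))) ca≤ (sort3-yzx s) e∉H₀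
    ... | no ab≰  | no bc≰  | no ca≰  = ⊥-elim (<⇒≱ (s≤s n≤6h+2) (begin
      suc (6 * h + 2)                          ≡⟨ three-arcs h ⟩
      suc (h + h) + suc (h + h) + suc (h + h)  ≤⟨ +-mono-≤ (+-mono-≤ (≰⇒> ab≰) (≰⇒> bc≰)) (≰⇒> ca≰) ⟩
      δ a b + δ b c + δ c a                    ≡⟨ δ-sum (inj₁ s) ⟩
      n                                        ∎))
      where
      open ≤-Reasoning
      three-arcs : ∀ h → suc (6 * h + 2) ≡ suc (h + h) + suc (h + h) + suc (h + h)
      three-arcs = solve-∀

    arcStarts : Fin n → List (Triple n)
    arcStarts x = map (λ j → sort3 x (x ⊕ j) (x ⊕ (j + (j + h)))) (upTo (suc h))

    H₀-cover : List (Triple n)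
    H₀-cover = concatMap arcStarts (allFin n)

    Step⇒∈H₀-cover : ∀ {x y z} → Cyc x y z → Step (δ x y) (δ y z) → sort3 x y z ∈ H₀-cover
    Step⇒∈H₀-cover {x} {y} {z} c (_ , δxy≤h , δyz≡δxy+h) = ∈-concatMap⁺ arcStarts (lose (∈-allFin x)
      (subst (_∈ arcStarts x) starts-at-x (∈-map⁺ _ (∈-upTo⁺ (s≤s δxy≤h)))))
      where
      δxz≡ : δ x z ≡ δ x y + (δ x y + h)
      δxz≡ = trans (δ-additive c) (cong (δ x y +_) δyz≡δxy+h)
      starts-at-x : sort3 x (x ⊕ δ x y) (x ⊕ (δ x y + (δ x y + h))) ≡ sort3 x y z
      starts-at-x = cong₂ (sort3 x) (⊕-δ x y) (trans (cong (x ⊕_) (sym δxz≡)) (⊕-δ x z))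

    H₀⊆H₀-cover : H₀ ⊆ H₀-cover
    H₀⊆H₀-cover {a , b , c} t∈ with ∈-filter⁻ Patterned? {xs = sortedTriples} t∈
    ... | t∈sorted , patterned with ∈-sortedTriples⁻ t∈sorted | patterned
    ...   | s | inj₁ st        = subst (_∈ H₀-cover) (sort3-xyz s) (Step⇒∈H₀-cover (inj₁ s) st)
    ...   | s | inj₂ (inj₁ st) = subst (_∈ H₀-cover) (sort3-zxy s) (Step⇒∈H₀-cover (Cyc-rotate (inj₁ s)) st)
    ...   | s | inj₂ (inj₂ st) =
      subst (_∈ H₀-cover) (sort3-yzx s) (Step⇒∈H₀-cover (Cyc-rotate (Cyc-rotate (inj₁ s))) st)

    length-H₀ : length H₀ ≤ n * suc h
    length-H₀ = begin
      length H₀                        ≤⟨ Unique⇒length≤ H₀-Unique H₀⊆H₀-cover ⟩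
      length H₀-cover                  ≤⟨ length-concatMap-≤ arcStarts (allFin n) (λ _ → ≤-reflexive length-arcStarts) ⟩
      length (allFin n) * suc h        ≡⟨ cong (_* suc h) (length-tabulate {n = n} id) ⟩
      n * suc h                        ∎
      where
      open ≤-Reasoning
      length-arcStarts : ∀ {x} → length (arcStarts x) ≡ suc h
      length-arcStarts = trans (length-map _ (upTo (suc h))) (length-upTo (suc h))

    H₀-graph : CGH n
    H₀-graph = cgh H₀ H₀-Sorted H₀-Unique

    H₀-D₂-Saturated : n ≤ 6 * h + 2 → D₂-Saturated H₀-graph
    H₀-D₂-Saturated n≤6h+2 = H₀-D₂-free , H₀-saturating n≤6h+2

    -- Opaque, because unfolding the argmin over all sublists in later unification problems makes
    -- type checking them intractable.
    opaque
      sat-bounds : n ≤ 6 * h + 2 →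
                   Σ ℕ λ k → IsSatD₂ n k × length (increasingTriples n) ≤ k * (n + n) × k ≤ n * suc h
      sat-bounds n≤6h+2 = k , isSat , IsSatD₂⇒triples≤ isSat , ≤-trans k≤|H₀| length-H₀
        where
        attained : Σ ℕ λ k → IsSatD₂ n k × k ≤ ∣ H₀-graph ∣ₑ
        attained = sat-attained H₀-graph (H₀-D₂-Saturated n≤6h+2)
        k : ℕ
        k = proj₁ attained
        isSat : IsSatD₂ n k
        isSat = proj₁ (proj₂ attained)
        k≤|H₀| : k ≤ ∣ H₀-graph ∣ₑ
        k≤|H₀| = proj₂ (proj₂ attained)

sat-estimates : ∀ {n h} → 0 < n → 5 * h < n → n ≤ 6 * h + 2 → 6 * h ≤ n + 3 →
                Σ ℕ λ k → IsSatD₂ n k × (n * n ≤ 12 * k + 36 * n) × (24 * k ≤ 5 * (n * n) + 36 * n)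
sat-estimates {n} {h} n>0 5h<n n≤6h+2 6h≤n+3 with Cycle.Construction.sat-bounds n h 5h<n n≤6h+2
... | k , isSat , triples≤ , k≤n[1+h] =
  k , isSat ,
  ≤-trans (lower-bound-arith {k = k} n>0 (length-increasingTriples n) triples≤) (+-monoʳ-≤ (12 * k) (*-monoˡ-≤ n (m≤m+n 3 33))) ,
  upper-bound-arith k≤n[1+h] 6h≤n+3

proposition4p14 : Σ ℕ λ C → Σ ℕ λ N → ∀ (n : ℕ) → N ≤ n →
    Σ ℕ λ k → IsSatD₂ n k ×
      (n * n ≤ 12 * k + C * n) × (24 * k ≤ 5 * (n * n) + C * n)
proposition4p14 = 36 , 16 , bounds
  where
  bounds : ∀ n → 16 ≤ n →
           Σ ℕ λ k → IsSatD₂ n k × (n * n ≤ 12 * k + 36 * n) × (24 * k ≤ 5 * (n * n) + 36 * n)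
  bounds n 16≤n with nearest-sixth n
  ... | h , n≤6h+2 , 6h≤n+3 = sat-estimates {n} {h} (<-≤-trans z<s 16≤n) (5h<n {n} {h} 16≤n 6h≤n+3) n≤6h+2 6h≤n+3
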